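{- Let $V$ be a non-empty set of valuations on a field $K$, and let $n \in \mathbb{N}$. The set $\bigcup_{v \in V} \mathfrak{m}_v$ has an $\exists_n$-$\mathcal{L}_{\rm ring}(K)$-definition in $K$ if and only if $\bigcap_{v \in V} \mathcal{O}_v$ has a $\forall_n$-$\mathcal{L}_{\rm ring}(K)$-definition in $K$.
   Context: $\mathcal{O}_v$ is the valuation ring of $v$ and $\mathfrak{m}_v$ its maximal ideal. $\mathcal{L}_{\rm ring}(K)$ is the signature of rings $\{0,1,+,-,\cdot\}$ with a constant symbol for each element of $K$. A subset of $K$ has an $\exists_n$- (resp. $\forall_n$-) $\mathcal{L}_{\rm ring}(K)$-definition if it is the set of elements satisfying in $K$ a formula logically equivalent to $\exists Y_1,\ldots,Y_n\,\psi$ (resp. $\forall Y_1,\ldots,Y_n\,\psi$) with $\psi$ quantifier-free. -}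

module Defs where

open import Level using (Level; _⊔_; Lift) renaming (suc to lsuc)
open import Data.Nat using (ℕ; suc)
open import Data.Fin using (Fin; zero)
open import Data.Product using (Σ; ∃; _×_)
open import Data.Sum using (_⊎_)
open import Data.Vec.Functional using (_∷_)
open import Relation.Nullary using (¬_)
open import Relation.Binary.Structures using (IsTotalOrder)
open import Algebra.Bundles using (CommutativeRing; AbelianGroup)
open import Function.Bundles using (_⇔_)

record Field (c ℓ : Level) : Set (lsuc (c ⊔ ℓ)) where
  field
    commRing : CommutativeRing c ℓ
  open CommutativeRing commRing public
  field
    1≉0      : ¬ (1# ≈ 0#)
    inverse  : ∀ x → ¬ (x ≈ 0#) → Σ Carrier λ y → x * y ≈ 1#

record OrderedAbelianGroup (g ℓ₁ ℓ₂ : Level) : Set (lsuc (g ⊔ ℓ₁ ⊔ ℓ₂)) where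
  field
    abGroup : AbelianGroup g ℓ₁
  open AbelianGroup abGroup public renaming (_∙_ to _+_; ε to 0#)
  field
    _≤_          : Carrier → Carrier → Set ℓ₂
    isTotalOrder : IsTotalOrder _≈_ _≤_
    +-mono-≤     : ∀ {x y} z → x ≤ y → (x + z) ≤ (y + z)

data WithInf {g} (G : Set g) : Set g where
  fin : G → WithInf G
  ∞   : WithInf G

module _ {g ℓ₁ ℓ₂} (Γ : OrderedAbelianGroup g ℓ₁ ℓ₂) where
  open OrderedAbelianGroup Γ

  Γ∞ : Set g
  Γ∞ = WithInf Carrier

  _≈∞_ : Γ∞ → Γ∞ → Set ℓ₁
  fin a ≈∞ fin b = a ≈ b
  fin a ≈∞ ∞     = Lift ℓ₁ Data.Empty.⊥
    where import Data.Empty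
  ∞     ≈∞ fin b = Lift ℓ₁ Data.Empty.⊥
    where import Data.Empty
  ∞     ≈∞ ∞     = Lift ℓ₁ Data.Unit.⊤
    where import Data.Unit

  _≤∞_ : Γ∞ → Γ∞ → Set ℓ₂
  fin a ≤∞ fin b = a ≤ b
  a     ≤∞ ∞     = Lift ℓ₂ Data.Unit.⊤
    where import Data.Unit
  ∞     ≤∞ fin b = Lift ℓ₂ Data.Empty.⊥
    where import Data.Empty

  _+∞_ : Γ∞ → Γ∞ → Γ∞
  fin a +∞ fin b = fin (a + b)
  fin a +∞ ∞     = ∞
  ∞     +∞ b     = ∞

  -- x ≤ y or y ≤ x decides the minimum; we phrase the ultrametric
  -- inequality v(x+y) ≥ min(v x, v y) as: v x ≤ v(x+y) or v y ≤ v(x+y).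

record Valuation {c ℓ} (K : Field c ℓ) (g ℓ₁ ℓ₂ : Level)
       : Set (lsuc (c ⊔ ℓ ⊔ g ⊔ ℓ₁ ⊔ ℓ₂)) where
  open Field K
  field
    Γ      : OrderedAbelianGroup g ℓ₁ ℓ₂
    v      : Carrier → Γ∞ Γ
    v-cong : ∀ {x y} → x ≈ y → _≈∞_ Γ (v x) (v y)
    v-∞    : ∀ x → (_≈∞_ Γ (v x) ∞ → x ≈ 0#) × (x ≈ 0# → _≈∞_ Γ (v x) ∞)
    v-*    : ∀ x y → _≈∞_ Γ (v (x * y)) (_+∞_ Γ (v x) (v y))
    v-+    : ∀ x y → _≤∞_ Γ (v x) (v (x + y)) ⊎ _≤∞_ Γ (v y) (v (x + y))

  open OrderedAbelianGroup Γ using () renaming (0# to 0Γ)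

  𝒪 : Carrier → Set ℓ₂
  𝒪 x = _≤∞_ Γ (fin 0Γ) (v x)

  𝔪 : Carrier → Set (ℓ₁ ⊔ ℓ₂)
  𝔪 x = _≤∞_ Γ (fin 0Γ) (v x) × ¬ (_≈∞_ Γ (fin 0Γ) (v x))

module _ {c ℓ} (K : Field c ℓ) where
  open Field K

  data Term (m : ℕ) : Set c where
    var   : Fin m → Term m
    const : Carrier → Term m
    𝟘 𝟙   : Term m
    _⊕_ _⊗_ : Term m → Term m → Term m
    ⊖_    : Term m → Term m

  data QFFormula (m : ℕ) : Set c where
    _≐_  : Term m → Term m → QFFormula m
    ⊤′ ⊥′ : QFFormula m
    ¬′_  : QFFormula m → QFFormula m
    _∧′_ _∨′_ : QFFormula m → QFFormula m → QFFormula m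

  evalT : ∀ {m} → Term m → (Fin m → Carrier) → Carrier
  evalT (var i)   ρ = ρ i
  evalT (const a) ρ = a
  evalT 𝟘         ρ = 0#
  evalT 𝟙         ρ = 1#
  evalT (s ⊕ t)   ρ = evalT s ρ + evalT t ρ
  evalT (s ⊗ t)   ρ = evalT s ρ * evalT t ρ
  evalT (⊖ t)     ρ = - evalT t ρ

  Sat : ∀ {m} → QFFormula m → (Fin m → Carrier) → Set ℓ
  Sat (s ≐ t)   ρ = evalT s ρ ≈ evalT t ρ
  Sat ⊤′        ρ = Lift ℓ Data.Unit.⊤
    where import Data.Unit
  Sat ⊥′        ρ = Lift ℓ Data.Empty.⊥
    where import Data.Empty
  Sat (¬′ φ)    ρ = ¬ Sat φ ρ
  Sat (φ ∧′ ψ)  ρ = Sat φ ρ × Sat ψ ρ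
  Sat (φ ∨′ ψ)  ρ = Sat φ ρ ⊎ Sat ψ ρ

  -- S ⊆ K is ∃ₙ-definable: S = { x | ∃ Y₁…Yₙ ψ(x,Y) } with ψ quantifier-free
  -- (variable zero is x, variables suc i are the Yᵢ)
  ∃-Definable : ∀ {s} → ℕ → (Carrier → Set s) → Set (c ⊔ ℓ ⊔ s)
  ∃-Definable n S = Σ (QFFormula (suc n)) λ ψ →
    ∀ x → S x ⇔ Σ (Fin n → Carrier) (λ y → Sat ψ (x ∷ y))

  ∀-Definable : ∀ {s} → ℕ → (Carrier → Set s) → Set (c ⊔ ℓ ⊔ s)
  ∀-Definable n S = Σ (QFFormula (suc n)) λ ψ →
    ∀ x → S x ⇔ ((y : Fin n → Carrier) → Sat ψ (x ∷ y))

{-# OPTIONS --safe #-}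
module Submission where

-- If x ≠ 0, then v x + v x⁻¹ = 0 for every valuation v, so x lies in every
-- 𝒪_v exactly when x⁻¹ lies in no 𝔪_v.  Hence ⋂ 𝒪_v = {0} ∪ {x ≠ 0 | x⁻¹ ∉ ⋃ 𝔪_v}
-- and ⋃ 𝔪_v = {0} ∪ {x ≠ 0 | x⁻¹ ∉ ⋂ 𝒪_v}.  Substituting x⁻¹ for x in a
-- quantifier-free formula stays quantifier-free once every equation is multiplied
-- by a suitable power of x, and passing to the complement swaps ∃ₙ and ∀ₙ.

open import Defs
open import Algebra.Bundles using (CommutativeRing)
open import Level using (_⊔_; lift)
open import Data.Nat using (ℕ; zero; suc) renaming (_+_ to _+ℕ_)
open import Data.Fin using (Fin; zero; suc)
open import Data.Product using (Σ; ∃; _×_; _,_; proj₁; proj₂)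
open import Data.Product.Function.NonDependent.Propositional using (_×-⇔_)
open import Data.Sum using (_⊎_; inj₁; inj₂; [_,_]′)
open import Data.Sum.Function.Propositional using (_⊎-⇔_)
open import Data.Empty using (⊥-elim)
open import Data.Unit using (tt)
open import Data.Vec.Functional using (_∷_)
open import Relation.Nullary using (¬_; Dec; yes; no)
open import Relation.Nullary.Decidable using (decidable-stable)
open import Relation.Binary.Structures using (IsTotalOrder)
open import Function.Base using (_∘_; id)
open import Function.Bundles using (_⇔_; mk⇔; Equivalence)
open import Function.Construct.Identity using (⇔-id)
open import Function.Related.TypeIsomorphisms using (¬-cong-⇔)
open import Axiom.ExcludedMiddle using (ExcludedMiddle)
import Algebra.Properties.CommutativeSemigroup as CommutativeSemigroupProperties
import Algebra.Properties.Ring as RingProperties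
import Algebra.Properties.Semiring.Exp as SemiringExp

open Equivalence using (to; from)

¬∀⇒∃¬ : (∀ {a} → ExcludedMiddle a) →
        ∀ {a p} {A : Set a} {P : A → Set p} → ¬ (∀ x → P x) → ∃ λ x → ¬ P x
¬∀⇒∃¬ lem {P = P} ¬∀P with lem {P = ∃ λ x → ¬ P x}
... | yes ∃¬P = ∃¬P
... | no ¬∃¬P = ⊥-elim (¬∀P λ x → decidable-stable lem (λ ¬Px → ¬∃¬P (x , ¬Px)))

module _ {c ℓ} (R : CommutativeRing c ℓ) where
  open CommutativeRing R hiding (zero)
  open import Relation.Binary.Reasoning.Setoid setoid
  open CommutativeSemigroupProperties *-commutativeSemigroup using (interchange)
  open SemiringExp semiring using (_^_)

  IsUnit : Carrier → Set (c ⊔ ℓ)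
  IsUnit w = ∃ λ z → w * z ≈ 1#

  IsUnit-* : ∀ {a b} → IsUnit a → IsUnit b → IsUnit (a * b)
  IsUnit-* {a} {b} (a′ , aa′≈1) (b′ , bb′≈1) = a′ * b′ , (begin
    (a * b) * (a′ * b′) ≈⟨ interchange a b a′ b′ ⟩
    (a * a′) * (b * b′) ≈⟨ *-cong aa′≈1 bb′≈1 ⟩
    1# * 1#             ≈⟨ *-identityˡ 1# ⟩
    1#                  ∎)

  IsUnit-^ : ∀ {a} → IsUnit a → ∀ d → IsUnit (a ^ d)
  IsUnit-^ _      zero    = 1# , *-identityˡ 1#
  IsUnit-^ a-unit (suc d) = IsUnit-* a-unit (IsUnit-^ a-unit d)

  IsUnit⇒≉0 : ¬ 1# ≈ 0# → ∀ {w} → IsUnit w → ¬ w ≈ 0#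
  IsUnit⇒≉0 1≉0 {w} (z , wz≈1) w≈0 = 1≉0 (begin
    1#     ≈⟨ wz≈1 ⟨
    w * z  ≈⟨ *-congʳ w≈0 ⟩
    0# * z ≈⟨ zeroˡ z ⟩
    0#     ∎)

  *-cancelˡ-unit : ∀ {w a b} → IsUnit w → w * a ≈ w * b → a ≈ b
  *-cancelˡ-unit {w} {a} {b} (z , wz≈1) wa≈wb = begin
    a            ≈⟨ *-identityˡ a ⟨
    1# * a       ≈⟨ *-congʳ zw≈1 ⟨
    (z * w) * a  ≈⟨ *-assoc z w a ⟩
    z * (w * a)  ≈⟨ *-congˡ wa≈wb ⟩
    z * (w * b)  ≈⟨ *-assoc z w b ⟨
    (z * w) * b  ≈⟨ *-congʳ zw≈1 ⟩
    1# * b       ≈⟨ *-identityˡ b ⟩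
    b            ∎
    where zw≈1 = trans (*-comm z w) wz≈1

module _ {c ℓ} (K : Field c ℓ) where
  open Field K hiding (zero)
  open import Relation.Binary.Reasoning.Setoid setoid
  open CommutativeSemigroupProperties *-commutativeSemigroup
    using (interchange; xy∙z≈xz∙y)
  open RingProperties ring using (-‿distribʳ-*)
  open SemiringExp semiring using (_^_; ^-homo-*)

  zero-or-unit-elim : ∀ {p} {P : Carrier → Set p} → (∀ x → Dec (x ≈ 0#)) →
                      (∀ {x} → x ≈ 0# → P x) → (∀ {x u} → x * u ≈ 1# → P x) → ∀ x → P x
  zero-or-unit-elim _≟0 P-zero P-unit x with x ≟0
  ... | yes x≈0 = P-zero x≈0
  ... | no  x≉0 = P-unit (proj₂ (inverse x x≉0))

  infix 25 X^_
  X^_ : ∀ {m} → ℕ → Term K (suc m)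
  X^ zero  = 𝟙
  X^ suc d = var zero ⊗ X^ d

  degree : ∀ {m} → Term K (suc m) → ℕ
  degree (var zero)    = 1
  degree (var (suc _)) = 0
  degree (const _)     = 0
  degree 𝟘             = 0
  degree 𝟙             = 0
  degree (s ⊕ t)       = degree s +ℕ degree t
  degree (s ⊗ t)       = degree s +ℕ degree t
  degree (⊖ t)         = degree t

  -- clearInverse t is X^(degree t) · t(1/X, Y) with the denominators cleared;
  -- degree only bounds the degree in X from above, which is all that is needed.
  clearInverse : ∀ {m} → Term K (suc m) → Term K (suc m)
  clearInverse (var zero)    = 𝟙
  clearInverse (var (suc i)) = var (suc i)
  clearInverse (const a)     = const a
  clearInverse 𝟘             = 𝟘
  clearInverse 𝟙             = 𝟙
  clearInverse (s ⊕ t)       = (clearInverse s ⊗ X^ degree t) ⊕ (X^ degree s ⊗ clearInverse t)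
  clearInverse (s ⊗ t)       = clearInverse s ⊗ clearInverse t
  clearInverse (⊖ t)         = ⊖ clearInverse t

  clearInverseF : ∀ {m} → QFFormula K (suc m) → QFFormula K (suc m)
  clearInverseF (s ≐ t)  = (clearInverse s ⊗ X^ degree t) ≐ (X^ degree s ⊗ clearInverse t)
  clearInverseF ⊤′       = ⊤′
  clearInverseF ⊥′       = ⊥′
  clearInverseF (¬′ φ)   = ¬′ clearInverseF φ
  clearInverseF (φ ∧′ ψ) = clearInverseF φ ∧′ clearInverseF ψ
  clearInverseF (φ ∨′ ψ) = clearInverseF φ ∨′ clearInverseF ψ

  inverseComplement : ∀ {m} → QFFormula K (suc m) → QFFormula K (suc m)
  inverseComplement φ = (var zero ≐ 𝟘) ∨′ (¬′ clearInverseF φ)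

  evalT-X^ : ∀ {m} d (ρ : Fin (suc m) → Carrier) → evalT K (X^ d) ρ ≈ ρ zero ^ d
  evalT-X^ zero    ρ = refl
  evalT-X^ (suc d) ρ = *-congˡ (evalT-X^ d ρ)

  module _ {m} {x u : Carrier} (xu≈1 : x * u ≈ 1#) (y : Fin m → Carrier) where

    evalT-clearInverse : ∀ t → evalT K (clearInverse t) (x ∷ y) ≈ x ^ degree t * evalT K t (u ∷ y)
    evalT-clearInverse-⊗X^ : ∀ s e → evalT K (clearInverse s ⊗ X^ e) (x ∷ y)
                                     ≈ x ^ (degree s +ℕ e) * evalT K s (u ∷ y)
    evalT-X^⊗clearInverse : ∀ e t → evalT K (X^ e ⊗ clearInverse t) (x ∷ y)
                                    ≈ x ^ (e +ℕ degree t) * evalT K t (u ∷ y)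

    evalT-clearInverse (var zero)    = sym (trans (*-congʳ (*-identityʳ x)) xu≈1)
    evalT-clearInverse (var (suc _)) = sym (*-identityˡ _)
    evalT-clearInverse (const a)     = sym (*-identityˡ a)
    evalT-clearInverse 𝟘             = sym (*-identityˡ 0#)
    evalT-clearInverse 𝟙             = sym (*-identityˡ 1#)
    evalT-clearInverse (s ⊕ t)       =
      trans (+-cong (evalT-clearInverse-⊗X^ s (degree t)) (evalT-X^⊗clearInverse (degree s) t))
            (sym (distribˡ _ _ _))
    evalT-clearInverse (s ⊗ t)       = begin
      evalT K (clearInverse s) (x ∷ y) * evalT K (clearInverse t) (x ∷ y)
        ≈⟨ *-cong (evalT-clearInverse s) (evalT-clearInverse t) ⟩
      (x ^ degree s * _) * (x ^ degree t * _)  ≈⟨ interchange _ _ _ _ ⟩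
      (x ^ degree s * x ^ degree t) * _        ≈⟨ *-congʳ (^-homo-* x (degree s) (degree t)) ⟨
      x ^ (degree s +ℕ degree t) * _           ∎
    evalT-clearInverse (⊖ t)         = trans (-‿cong (evalT-clearInverse t)) (-‿distribʳ-* _ _)

    evalT-clearInverse-⊗X^ s e = begin
      evalT K (clearInverse s) (x ∷ y) * evalT K (X^ e) (x ∷ y)
        ≈⟨ *-cong (evalT-clearInverse s) (evalT-X^ e (x ∷ y)) ⟩
      (x ^ degree s * _) * x ^ e  ≈⟨ xy∙z≈xz∙y _ _ _ ⟩
      (x ^ degree s * x ^ e) * _  ≈⟨ *-congʳ (^-homo-* x (degree s) e) ⟨
      x ^ (degree s +ℕ e) * _     ∎

    evalT-X^⊗clearInverse e t = begin
      evalT K (X^ e) (x ∷ y) * evalT K (clearInverse t) (x ∷ y)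
        ≈⟨ *-cong (evalT-X^ e (x ∷ y)) (evalT-clearInverse t) ⟩
      x ^ e * (x ^ degree t * _)  ≈⟨ *-assoc _ _ _ ⟨
      (x ^ e * x ^ degree t) * _  ≈⟨ *-congʳ (^-homo-* x e (degree t)) ⟨
      x ^ (e +ℕ degree t) * _     ∎

    Sat-clearInverseF : ∀ φ → Sat K (clearInverseF φ) (x ∷ y) ⇔ Sat K φ (u ∷ y)
    Sat-clearInverseF (s ≐ t)  = mk⇔
      (λ eq → *-cancelˡ-unit commRing x^N-unit (trans (sym lhs) (trans eq rhs)))
      (λ eq → trans lhs (trans (*-congˡ eq) (sym rhs)))
      where
      x^N-unit = IsUnit-^ commRing (u , xu≈1) (degree s +ℕ degree t)
      lhs = evalT-clearInverse-⊗X^ s (degree t)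
      rhs = evalT-X^⊗clearInverse (degree s) t
    Sat-clearInverseF ⊤′       = ⇔-id _
    Sat-clearInverseF ⊥′       = ⇔-id _
    Sat-clearInverseF (¬′ φ)   = ¬-cong-⇔ (Sat-clearInverseF φ)
    Sat-clearInverseF (φ ∧′ ψ) = Sat-clearInverseF φ ×-⇔ Sat-clearInverseF ψ
    Sat-clearInverseF (φ ∨′ ψ) = Sat-clearInverseF φ ⊎-⇔ Sat-clearInverseF ψ

    Sat-inverseComplement : ∀ φ → Sat K (inverseComplement φ) (x ∷ y) ⇔ (¬ Sat K φ (u ∷ y))
    Sat-inverseComplement φ = mk⇔
      [ ⊥-elim ∘ IsUnit⇒≉0 commRing 1≉0 (u , xu≈1) , _∘ from (Sat-clearInverseF φ) ]′
      (inj₂ ∘ (_∘ to (Sat-clearInverseF φ)))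

  ∃-Definable⇒∀-Definable : ∀ {n s t} {S : Carrier → Set s} {T : Carrier → Set t} →
    (∀ x → Dec (x ≈ 0#)) → (∀ {x} → x ≈ 0# → T x) →
    (∀ {x u} → x * u ≈ 1# → T x ⇔ (¬ S u)) →
    ∃-Definable K n S → ∀-Definable K n T
  ∃-Definable⇒∀-Definable {T = T} _≟0 T-zero T⇔¬S (ψ , S⇔∃ψ) =
    inverseComplement ψ , zero-or-unit-elim _≟0 T⇔∀-zero T⇔∀-unit
    where
    T⇔∀-zero : ∀ {x} → x ≈ 0# → T x ⇔ (∀ y → Sat K (inverseComplement ψ) (x ∷ y))
    T⇔∀-zero x≈0 = mk⇔ (λ _ _ → inj₁ x≈0) (λ _ → T-zero x≈0)

    T⇔∀-unit : ∀ {x u} → x * u ≈ 1# → T x ⇔ (∀ y → Sat K (inverseComplement ψ) (x ∷ y))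
    T⇔∀-unit {u = u} xu≈1 = mk⇔
      (λ Tx y → from (Sat-inverseComplement xu≈1 y ψ)
                     (λ ψuy → to (T⇔¬S xu≈1) Tx (from (S⇔∃ψ u) (y , ψuy))))
      (λ ∀y → from (T⇔¬S xu≈1) λ Su →
         let (y , ψuy) = to (S⇔∃ψ u) Su in to (Sat-inverseComplement xu≈1 y ψ) (∀y y) ψuy)

  ∀-Definable⇒∃-Definable : ∀ {n s t} {S : Carrier → Set s} {T : Carrier → Set t} →
    (∀ {a} → ExcludedMiddle a) → (∀ {x} → x ≈ 0# → S x) →
    (∀ {x u} → x * u ≈ 1# → S x ⇔ (¬ T u)) →
    ∀-Definable K n T → ∃-Definable K n S
  ∀-Definable⇒∃-Definable {S = S} lem S-zero S⇔¬T (φ , T⇔∀φ) =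
    inverseComplement φ , zero-or-unit-elim (λ _ → lem) S⇔∃-zero S⇔∃-unit
    where
    S⇔∃-zero : ∀ {x} → x ≈ 0# → S x ⇔ Σ _ (λ y → Sat K (inverseComplement φ) (x ∷ y))
    S⇔∃-zero x≈0 = mk⇔ (λ _ → (λ _ → 0#) , inj₁ x≈0) (λ _ → S-zero x≈0)

    S⇔∃-unit : ∀ {x u} → x * u ≈ 1# → S x ⇔ Σ _ (λ y → Sat K (inverseComplement φ) (x ∷ y))
    S⇔∃-unit {u = u} xu≈1 = mk⇔
      (λ Sx → let (y , ¬φuy) = ¬∀⇒∃¬ lem (to (S⇔¬T xu≈1) Sx ∘ from (T⇔∀φ u))
              in y , from (Sat-inverseComplement xu≈1 y φ) ¬φuy)
      (λ (y , φ*xy) → from (S⇔¬T xu≈1) λ Tu →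
         to (Sat-inverseComplement xu≈1 y φ) φ*xy (to (T⇔∀φ u) Tu y))

module _ {g ℓ₁ ℓ₂} (Γ : OrderedAbelianGroup g ℓ₁ ℓ₂) where
  open OrderedAbelianGroup Γ
  open IsTotalOrder isTotalOrder
    using (total; antisym; ≤-respˡ-≈; ≤-respʳ-≈) renaming (reflexive to ≤-reflexive)

  0≤a⇒b≤0 : ∀ {a b} → a + b ≈ 0# → 0# ≤ a → b ≤ 0#
  0≤a⇒b≤0 {b = b} a+b≈0 0≤a = ≤-respʳ-≈ a+b≈0 (≤-respˡ-≈ (identityˡ b) (+-mono-≤ b 0≤a))

  0≰a⇒0≤b : ∀ {a b} → a + b ≈ 0# → ¬ 0# ≤ a → 0# ≤ b
  0≰a⇒0≤b {a} {b} a+b≈0 0≰a with total 0# a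
  ... | inj₁ 0≤a = ⊥-elim (0≰a 0≤a)
  ... | inj₂ a≤0 = ≤-respʳ-≈ (identityˡ b) (≤-respˡ-≈ a+b≈0 (+-mono-≤ b a≤0))

  0≰a⇒0≉b : ∀ {a b} → a + b ≈ 0# → ¬ 0# ≤ a → ¬ 0# ≈ b
  0≰a⇒0≉b {a} a+b≈0 0≰a 0≈b =
    0≰a (≤-reflexive (sym (trans (sym (identityʳ a)) (trans (∙-congˡ 0≈b) a+b≈0))))

  a+a≈a⇒a≈0 : ∀ {a} → a + a ≈ a → a ≈ 0#
  a+a≈a⇒a≈0 {a} a+a≈a = begin
    a              ≈⟨ identityʳ a ⟨
    a + 0#         ≈⟨ ∙-congˡ (inverseʳ a) ⟨
    a + (a + a ⁻¹) ≈⟨ assoc a a (a ⁻¹) ⟨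
    (a + a) + a ⁻¹ ≈⟨ ∙-congʳ a+a≈a ⟩
    a + a ⁻¹       ≈⟨ inverseʳ a ⟩
    0#             ∎
    where open import Relation.Binary.Reasoning.Setoid setoid

  ≈∞-sym : ∀ p q → _≈∞_ Γ p q → _≈∞_ Γ q p
  ≈∞-sym (fin _) (fin _) a≈b = sym a≈b
  ≈∞-sym (fin _) ∞       (lift ())
  ≈∞-sym ∞       (fin _) (lift ())
  ≈∞-sym ∞       ∞       _ = lift tt

  ≈∞-trans : ∀ p q r → _≈∞_ Γ p q → _≈∞_ Γ q r → _≈∞_ Γ p r
  ≈∞-trans (fin _) (fin _) (fin _) a≈b b≈c = trans a≈b b≈c
  ≈∞-trans (fin _) (fin _) ∞       _ (lift ())
  ≈∞-trans (fin _) ∞       _       (lift ())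
  ≈∞-trans ∞       (fin _) _       (lift ())
  ≈∞-trans ∞       ∞       (fin _) _ (lift ())
  ≈∞-trans ∞       ∞       ∞       _ _ = lift tt

  +∞-idem⇒0⊎∞ : ∀ p → _≈∞_ Γ (_+∞_ Γ p p) p → _≈∞_ Γ p (fin 0#) ⊎ _≈∞_ Γ p ∞
  +∞-idem⇒0⊎∞ (fin _) a+a≈a = inj₁ (a+a≈a⇒a≈0 a+a≈a)
  +∞-idem⇒0⊎∞ ∞       _     = inj₂ (lift tt)

  NonNegative : Γ∞ Γ → Set ℓ₂
  NonNegative p = _≤∞_ Γ (fin 0#) p

  Positive : Γ∞ Γ → Set (ℓ₁ ⊔ ℓ₂)
  Positive p = NonNegative p × ¬ _≈∞_ Γ (fin 0#) p

  ∞-nonNegative : ∀ p → _≈∞_ Γ p ∞ → NonNegative p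
  ∞-nonNegative ∞ _ = lift tt

  ∞-positive : ∀ p → _≈∞_ Γ p ∞ → Positive p
  ∞-positive ∞ _ = lift tt , λ ()

  nonNegative⇒¬positive : ∀ p q → _≈∞_ Γ (_+∞_ Γ p q) (fin 0#) → NonNegative p → ¬ Positive q
  nonNegative⇒¬positive (fin _) (fin _) a+b≈0 0≤a (0≤b , 0≉b) =
    0≉b (antisym 0≤b (0≤a⇒b≤0 a+b≈0 0≤a))
  nonNegative⇒¬positive (fin _) ∞ (lift ())
  nonNegative⇒¬positive ∞       _ (lift ())

  ¬nonNegative⇒positive : ∀ p q → _≈∞_ Γ (_+∞_ Γ p q) (fin 0#) → ¬ NonNegative p → Positive q
  ¬nonNegative⇒positive (fin _) (fin _) a+b≈0 0≰a = 0≰a⇒0≤b a+b≈0 0≰a , 0≰a⇒0≉b a+b≈0 0≰a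
  ¬nonNegative⇒positive (fin _) ∞ (lift ())
  ¬nonNegative⇒positive ∞       _ (lift ())

module _ {c ℓ g ℓ₁ ℓ₂} {K : Field c ℓ} (V : Valuation K g ℓ₁ ℓ₂) where
  open Field K
  open Valuation V
  open OrderedAbelianGroup Γ using () renaming (0# to 0Γ)

  v-1 : _≈∞_ Γ (v 1#) (fin 0Γ)
  v-1 = [ id , ⊥-elim ∘ 1≉0 ∘ proj₁ (v-∞ 1#) ]′ (+∞-idem⇒0⊎∞ Γ (v 1#) v1+v1≈v1)
    where
    v1+v1≈v1 : _≈∞_ Γ (_+∞_ Γ (v 1#) (v 1#)) (v 1#)
    v1+v1≈v1 = ≈∞-trans Γ (_+∞_ Γ (v 1#) (v 1#)) (v (1# * 1#)) (v 1#)
                 (≈∞-sym Γ (v (1# * 1#)) (_+∞_ Γ (v 1#) (v 1#)) (v-* 1# 1#))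
                 (v-cong (*-identityˡ 1#))

  v-inverse : ∀ {x u} → x * u ≈ 1# → _≈∞_ Γ (_+∞_ Γ (v x) (v u)) (fin 0Γ)
  v-inverse {x} {u} xu≈1 =
    ≈∞-trans Γ (_+∞_ Γ (v x) (v u)) (v (x * u)) (fin 0Γ)
      (≈∞-sym Γ (v (x * u)) (_+∞_ Γ (v x) (v u)) (v-* x u))
      (≈∞-trans Γ (v (x * u)) (v 1#) (fin 0Γ) (v-cong xu≈1) v-1)

  0∈𝒪 : ∀ {x} → x ≈ 0# → 𝒪 x
  0∈𝒪 {x} x≈0 = ∞-nonNegative Γ (v x) (proj₂ (v-∞ x) x≈0)

  0∈𝔪 : ∀ {x} → x ≈ 0# → 𝔪 x
  0∈𝔪 {x} x≈0 = ∞-positive Γ (v x) (proj₂ (v-∞ x) x≈0)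

  𝒪⇒inverse∉𝔪 : ∀ {x u} → x * u ≈ 1# → 𝒪 x → ¬ 𝔪 u
  𝒪⇒inverse∉𝔪 {x} {u} xu≈1 = nonNegative⇒¬positive Γ (v x) (v u) (v-inverse xu≈1)

  ∉𝒪⇒inverse∈𝔪 : ∀ {x u} → x * u ≈ 1# → ¬ 𝒪 x → 𝔪 u
  ∉𝒪⇒inverse∈𝔪 {x} {u} xu≈1 = ¬nonNegative⇒positive Γ (v x) (v u) (v-inverse xu≈1)

module _ {c ℓ ι g ℓ₁ ℓ₂} {K : Field c ℓ} {I : Set ι} (V : I → Valuation K g ℓ₁ ℓ₂) where
  open Field K

  ⋂𝒪 : Carrier → Set (ι ⊔ ℓ₂)
  ⋂𝒪 x = ∀ i → Valuation.𝒪 (V i) x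

  ⋃𝔪 : Carrier → Set (ι ⊔ ℓ₁ ⊔ ℓ₂)
  ⋃𝔪 x = Σ I λ i → Valuation.𝔪 (V i) x

  ⋂𝒪⇔inverse∉⋃𝔪 : (∀ {a} → ExcludedMiddle a) → ∀ {x u} → x * u ≈ 1# → ⋂𝒪 x ⇔ (¬ ⋃𝔪 u)
  ⋂𝒪⇔inverse∉⋃𝔪 lem xu≈1 = mk⇔
    (λ x∈⋂𝒪 (i , u∈𝔪) → 𝒪⇒inverse∉𝔪 (V i) xu≈1 (x∈⋂𝒪 i) u∈𝔪)
    (λ u∉⋃𝔪 i → decidable-stable lem λ x∉𝒪 → u∉⋃𝔪 (i , ∉𝒪⇒inverse∈𝔪 (V i) xu≈1 x∉𝒪))

  ⋃𝔪⇔inverse∉⋂𝒪 : (∀ {a} → ExcludedMiddle a) → ∀ {x u} → x * u ≈ 1# → ⋃𝔪 x ⇔ (¬ ⋂𝒪 u)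
  ⋃𝔪⇔inverse∉⋂𝒪 lem {x} {u} xu≈1 = mk⇔
    (λ (i , x∈𝔪) u∈⋂𝒪 → 𝒪⇒inverse∉𝔪 (V i) ux≈1 (u∈⋂𝒪 i) x∈𝔪)
    (λ u∉⋂𝒪 → let (i , u∉𝒪) = ¬∀⇒∃¬ lem u∉⋂𝒪 in i , ∉𝒪⇒inverse∈𝔪 (V i) ux≈1 u∉𝒪)
    where ux≈1 = trans (*-comm u x) xu≈1

lemma5p1 : (lem : ∀ {a} → ExcludedMiddle a)
    → ∀ {c ℓ ι g ℓ₁ ℓ₂} (K : Field c ℓ) (I : Set ι) (i₀ : I)
      (V : I → Valuation K g ℓ₁ ℓ₂) (n : ℕ)
    → ∃-Definable K n (λ x → Σ I λ i → Valuation.𝔪 (V i) x)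
      ⇔ ∀-Definable K n (λ x → (i : I) → Valuation.𝒪 (V i) x)
lemma5p1 lem K I i₀ V n = mk⇔
  (∃-Definable⇒∀-Definable K (λ _ → lem) (λ x≈0 i → 0∈𝒪 (V i) x≈0) (⋂𝒪⇔inverse∉⋃𝔪 V lem))
  (∀-Definable⇒∃-Definable K lem (λ x≈0 → i₀ , 0∈𝔪 (V i₀) x≈0) (⋃𝔪⇔inverse∉⋂𝒪 V lem))
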